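{- Let $\pi$ be a half-decreasing permutation of length $n\ge 3$. If $n=2m+1$ is odd, then $$s_{\{123,132\}}(\pi)=\pi(3)\pi(2)\pi(5)\pi(4)\cdots\pi(2m+1)\pi(2m)\pi(1),$$ and if $n=2m+2$ is even, then $$s_{\{123,132\}}(\pi)=\pi(2)\pi(4)\pi(3)\pi(6)\pi(5)\cdots\pi(2m+2)\pi(2m+1)\pi(1).$$ In other words, the entries of the decreasing half are fixed in position and the remaining entries shift cyclically to the left.
   Context: A permutation $\pi$ of length $n$ is half-decreasing if the subsequence $\pi(n-1)\pi(n-3)\cdots\pi(2)$ (for odd $n$), respectively $\pi(n-1)\pi(n-3)\cdots\pi(3)$ (for even $n$), is literally equal to $1\,2\cdots\lfloor\frac{n-1}{2}\rfloor$ (i.e. $\pi(n-1)=1$, $\pi(n-3)=2$, etc.; being order-isomorphic to the identity is not sufficient); this subsequence is called its decreasing half. A sequence of distinct integers contains a permutation $\tau$ if some subsequence is order-isomorphic to $\tau$; otherwise it avoids $\tau$. For a set $T$ of permutations, the map $s_T$ is defined by: read the input permutation left to right with an initially empty stack and output; at each step, if there is a next input element and pushing it keeps the stack contents, read from top to bottom, $T$-avoiding, push it; otherwise pop the top of the stack and append it to the output; stop when input and stack are empty; the output is $s_T(\pi)$. -}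

module Defs where

open import Data.Nat using (ℕ; zero; suc; _+_; _*_; _∸_; _≤_; _<ᵇ_; _/_)
open import Data.Bool using (Bool; true; false; _∧_; not; if_then_else_)
open import Data.Bool.Properties using () renaming (_≟_ to _≟ᵇ_)
open import Data.List using (List; []; _∷_; _++_; map; concat; length; upTo; zipWith)
open import Data.Bool.ListAction using (all; any)
open import Data.List.Relation.Binary.Permutation.Propositional using (_↭_)
open import Relation.Nullary.Decidable using (⌊_⌋)
open import Relation.Binary.PropositionalEquality using (_≡_)

_==ᵇ_ : Bool → Bool → Bool
a ==ᵇ b = ⌊ a ≟ᵇ b ⌋

subseqs : ℕ → List ℕ → List (List ℕ)
subseqs zero    _        = [] ∷ []
subseqs (suc k) []       = []
subseqs (suc k) (x ∷ xs) = map (x ∷_) (subseqs k xs) ++ subseqs (suc k) xs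

headAgrees : ℕ → List ℕ → ℕ → List ℕ → Bool
headAgrees a as b bs =
  all (λ t → t) (zipWith (λ a' b' → ((a <ᵇ a') ==ᵇ (b <ᵇ b')) ∧ ((a' <ᵇ a) ==ᵇ (b' <ᵇ b))) as bs)

orderIso : List ℕ → List ℕ → Bool
orderIso []       []       = true
orderIso []       (_ ∷ _)  = false
orderIso (_ ∷ _)  []       = false
orderIso (a ∷ as) (b ∷ bs) = headAgrees a as b bs ∧ orderIso as bs

contains : List ℕ → List ℕ → Bool
contains τ σ = any (orderIso τ) (subseqs (length τ) σ)

avoidsAll : List (List ℕ) → List ℕ → Bool
avoidsAll T σ = all (λ τ → not (contains τ σ)) T

-- The stack is a list whose head is the top,
-- so the stack read top-to-bottom is the list itself. A fuel argument bounds
-- the number of steps (2 * n steps suffice: each step is a push or a pop).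
-- (The case "cannot push and stack empty" never arises for T without
-- patterns of length 1; we halt there.)
sortRun : List (List ℕ) → ℕ → List ℕ → List ℕ → List ℕ
sortRun T zero     _        _         = []
sortRun T (suc f)  []       []        = []
sortRun T (suc f)  []       (y ∷ st)  = y ∷ sortRun T f [] st
sortRun T (suc f)  (x ∷ xs) st with avoidsAll T (x ∷ st)
... | true  = sortRun T f xs (x ∷ st)
... | false with st
...   | []      = []
...   | y ∷ st' = y ∷ sortRun T f (x ∷ xs) st'

s : List (List ℕ) → List ℕ → List ℕ
s T π = sortRun T (2 * length π) π []

T123-132 : List (List ℕ)
T123-132 = (1 ∷ 2 ∷ 3 ∷ []) ∷ (1 ∷ 3 ∷ 2 ∷ []) ∷ []

IsPerm : List ℕ → Set
IsPerm π = π ↭ map suc (upTo (length π))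

-- 1-based entry π(i) (default 0 out of range; only used in range)
at : List ℕ → ℕ → ℕ
at []       _             = 0
at (x ∷ xs) zero          = 0
at (x ∷ xs) (suc zero)    = x
at (x ∷ xs) (suc (suc i)) = at xs (suc i)

HalfDecreasing : List ℕ → Set
HalfDecreasing π = ∀ j → 1 ≤ j → j ≤ (length π ∸ 1) / 2 → at π (length π + 1 ∸ 2 * j) ≡ j

oneTo : ℕ → List ℕ
oneTo m = map suc (upTo m)

oddPositions : ℕ → List ℕ
oddPositions m = concat (map (λ i → (2 * i + 1) ∷ (2 * i) ∷ []) (oneTo m)) ++ (1 ∷ [])

evenPositions : ℕ → List ℕ
evenPositions m = 2 ∷ concat (map (λ i → (2 * i + 2) ∷ (2 * i + 1) ∷ []) (oneTo m)) ++ (1 ∷ [])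

-- Write π = π(1) r. The decreasing half makes r = m x₁ (m-1) x₂ ⋯ 1 xₘ, and since π is a
-- permutation every xᵢ and π(1) exceed m. On such an input the machine handles the pairs
-- one at a time: with π(1) at the bottom of the stack, the pair k xᵢ is pushed (xᵢ > k); the
-- next entry k-1 is smaller than both, so it completes a 132 with xᵢ over k and then a 123
-- with k over π(1), which pops xᵢ and k. Hence the output is x₁ m x₂ (m-1) ⋯ xₘ 1 π(1).
-- For even length write π = π(1) π(2) r instead: π(2) sits on π(1) until m pops it.
module Submission where

open import Defs
open import Data.Nat using (ℕ; zero; suc; _+_; _*_; _∸_; _≤_; _<_; _≥_; _<ᵇ_; _/_; z<s; s≤s)
open import Data.Nat.Properties
open import Data.Nat.DivMod using (m*n/n≡m; /-monoˡ-≤)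
open import Data.Nat.Tactic.RingSolver using (solve-∀)
open import Data.Bool using (true; false; _∧_; not; T)
open import Data.Bool.Properties using (∧-zeroʳ)
open import Data.List
  using (List; []; _∷_; _++_; map; concat; length; head; applyUpTo; applyDownFrom; upTo)
open import Data.List.Properties using (map-++; map-concatMap; map-∘; map-upTo)
open import Data.List.Membership.Propositional using (_∈_; _∉_)
open import Data.List.Membership.Propositional.Properties using (∈-++⁺ʳ; ∈-applyDownFrom⁺)
open import Data.List.Relation.Unary.Any using (here; there)
open import Data.List.Relation.Unary.All as All using (All; _∷_)
import Data.List.Relation.Unary.All.Properties as All
open import Data.List.Relation.Unary.AllPairs using (_∷_)
open import Data.List.Relation.Unary.Unique.Propositional using (Unique)
import Data.List.Relation.Unary.Unique.Propositional.Properties as Unique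
open import Data.List.Relation.Binary.Permutation.Propositional
  using (_↭_; ↭-refl; ↭-prep; ↭-trans; ↭-sym; ↭⇒↭ₛ)
open import Data.List.Relation.Binary.Permutation.Propositional.Properties
  using (All-resp-↭; shift; shifts; ++⁺ˡ)
open import Relation.Binary.PropositionalEquality
open import Data.List.Relation.Binary.Permutation.Setoid.Properties (setoid ℕ)
  using (Unique-resp-↭)
import Data.Maybe.Relation.Unary.All as Maybe
open import Data.Product using (Σ-syntax; _×_; _,_)
open import Function using (_∘_)
open import Relation.Binary.Definitions using (tri<; tri≈; tri>)
open import Relation.Nullary using (yes; no; contradiction)

<⇒<ᵇ≡true : ∀ {m n} → m < n → (m <ᵇ n) ≡ true
<⇒<ᵇ≡true {m} {n} m<n with m <ᵇ n | <⇒<ᵇ m<n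
... | true | _ = refl

≥⇒<ᵇ≡false : ∀ {m n} → n ≤ m → (m <ᵇ n) ≡ false
≥⇒<ᵇ≡false {m} {n} n≤m with m <ᵇ n in eq
... | false = refl
... | true  = contradiction (<ᵇ⇒< m n (subst T (sym eq) _)) (≤⇒≯ n≤m)

orderIso-123 : ∀ {a b c} → a < b → b < c → orderIso (1 ∷ 2 ∷ 3 ∷ []) (a ∷ b ∷ c ∷ []) ≡ true
orderIso-123 {a} {b} {c} a<b b<c
  rewrite <⇒<ᵇ≡true a<b | ≥⇒<ᵇ≡false {b} {a} (<⇒≤ a<b)
        | <⇒<ᵇ≡true (<-trans a<b b<c) | ≥⇒<ᵇ≡false {c} {a} (<⇒≤ (<-trans a<b b<c))
        | <⇒<ᵇ≡true b<c | ≥⇒<ᵇ≡false {c} {b} (<⇒≤ b<c) = refl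

orderIso-132 : ∀ {a b c} → a < c → c < b → orderIso (1 ∷ 3 ∷ 2 ∷ []) (a ∷ b ∷ c ∷ []) ≡ true
orderIso-132 {a} {b} {c} a<c c<b
  rewrite <⇒<ᵇ≡true (<-trans a<c c<b) | ≥⇒<ᵇ≡false {b} {a} (<⇒≤ (<-trans a<c c<b))
        | <⇒<ᵇ≡true a<c | ≥⇒<ᵇ≡false {c} {a} (<⇒≤ a<c)
        | <⇒<ᵇ≡true c<b | ≥⇒<ᵇ≡false {b} {c} (<⇒≤ c<b) = refl

contains-prefix : ∀ {p q r a b c} st → orderIso (p ∷ q ∷ r ∷ []) (a ∷ b ∷ c ∷ []) ≡ true →
  contains (p ∷ q ∷ r ∷ []) (a ∷ b ∷ c ∷ st) ≡ true
contains-prefix st iso rewrite iso = refl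

contains⇒avoidsAll≡false : ∀ {T τ} σ → τ ∈ T → contains τ σ ≡ true → avoidsAll T σ ≡ false
contains⇒avoidsAll≡false {_ ∷ T} σ (here refl) c = cong (λ b → not b ∧ avoidsAll T σ) c
contains⇒avoidsAll≡false {τ ∷ _} σ (there τ∈T) c =
  trans (cong (not (contains τ σ) ∧_) (contains⇒avoidsAll≡false σ τ∈T c)) (∧-zeroʳ _)

-- Both patterns start with their least entry, so a stack avoids them iff no entry is smaller
-- than two distinct entries beneath it.
avoidsAll-descent≡true : ∀ {a b c} → b < a → avoidsAll T123-132 (a ∷ b ∷ c ∷ []) ≡ true
avoidsAll-descent≡true {a} {b} b<a rewrite ≥⇒<ᵇ≡false {a} {b} (<⇒≤ b<a) = refl

avoidsAll-least≡false : ∀ {a b c} st → a < b → a < c → b ≢ c →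
  avoidsAll T123-132 (a ∷ b ∷ c ∷ st) ≡ false
avoidsAll-least≡false {a} {b} {c} st a<b a<c b≢c with <-cmp b c
... | tri< b<c _ _ = contains⇒avoidsAll≡false {T123-132} (a ∷ b ∷ c ∷ st) (here refl)
                       (contains-prefix st (orderIso-123 a<b b<c))
... | tri≈ _ b≡c _ = contradiction b≡c b≢c
... | tri> _ _ c<b = contains⇒avoidsAll≡false {T123-132} (a ∷ b ∷ c ∷ st) (there (here refl))
                       (contains-prefix st (orderIso-132 a<c c<b))

sortRun-push : ∀ T {F x xs st} → avoidsAll T (x ∷ st) ≡ true →
  sortRun T (suc F) (x ∷ xs) st ≡ sortRun T F xs (x ∷ st)
sortRun-push _ ok rewrite ok = refl

sortRun-pop : ∀ T {F x xs y st} → avoidsAll T (x ∷ y ∷ st) ≡ false →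
  sortRun T (suc F) (x ∷ xs) (y ∷ st) ≡ y ∷ sortRun T F (x ∷ xs) st
sortRun-pop _ blocked rewrite blocked = refl

sortRun-halt : ∀ T F → sortRun T F [] [] ≡ []
sortRun-halt T zero    = refl
sortRun-halt T (suc F) = refl

sortRun-popAbove : ∀ {F b c st} r → Maybe.All (λ a → a < b × a < c) (head r) → b ≢ c →
  sortRun T123-132 (suc F) r (b ∷ c ∷ st) ≡ b ∷ sortRun T123-132 F r (c ∷ st)
sortRun-popAbove []      _                  _   = refl
sortRun-popAbove {b = b} {c} {st} (a ∷ _) (Maybe.just (a<b , a<c)) b≢c =
  sortRun-pop T123-132 {x = a} {y = b} {st = c ∷ st} (avoidsAll-least≡false st a<b a<c b≢c)

sortRun-pair : ∀ {F y x x₀} r → y < x → y < x₀ → Maybe.All (_< y) (head r) →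
  sortRun T123-132 (4 + F) (y ∷ x ∷ r) (x₀ ∷ []) ≡ x ∷ y ∷ sortRun T123-132 F r (x₀ ∷ [])
sortRun-pair {F} {y} {x} {x₀} r y<x y<x₀ next<y = begin
    sortRun T123-132 (3 + F) (x ∷ r) (y ∷ x₀ ∷ [])
  ≡⟨ sortRun-push T123-132 {x = x} {st = y ∷ x₀ ∷ []} (avoidsAll-descent≡true {c = x₀} y<x) ⟩
    sortRun T123-132 (2 + F) r (x ∷ y ∷ x₀ ∷ [])
  ≡⟨ sortRun-popAbove r (Maybe.map (λ a<y → <-trans a<y y<x , a<y) next<y) (>⇒≢ y<x) ⟩
    x ∷ sortRun T123-132 (1 + F) r (y ∷ x₀ ∷ [])
  ≡⟨ cong (x ∷_)
       (sortRun-popAbove r (Maybe.map (λ a<y → a<y , <-trans a<y y<x₀) next<y) (<⇒≢ y<x₀)) ⟩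
    x ∷ y ∷ sortRun T123-132 F r (x₀ ∷ [])
  ∎
  where open ≡-Reasoning

countdownWith : List ℕ → List ℕ
countdownWith []       = []
countdownWith (x ∷ xs) = suc (length xs) ∷ x ∷ countdownWith xs

swapPairs : List ℕ → List ℕ
swapPairs (a ∷ b ∷ r) = b ∷ a ∷ swapPairs r
swapPairs _           = []

head-countdownWith : ∀ xs → Maybe.All (_≤ length xs) (head (countdownWith xs))
head-countdownWith []      = Maybe.nothing
head-countdownWith (_ ∷ _) = Maybe.just ≤-refl

-- Fuel and positions are written n * 2 rather than 2 * n: suc n * 2 reduces to 2 + n * 2.
sortRun-countdownWith : ∀ F x₀ xs → All (length xs <_) (x₀ ∷ xs) →
  sortRun T123-132 (length (countdownWith xs) * 2 + 1 + F) (countdownWith xs) (x₀ ∷ [])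
    ≡ swapPairs (countdownWith xs) ++ x₀ ∷ []
sortRun-countdownWith F x₀ []       _                   = cong (x₀ ∷_) (sortRun-halt T123-132 F)
sortRun-countdownWith F x₀ (x ∷ xs) (k<x₀ ∷ k<x ∷ k<xs) = begin
    sortRun T123-132 (4 + (length (countdownWith xs) * 2 + 1 + F))
      (suc (length xs) ∷ x ∷ countdownWith xs) (x₀ ∷ [])
  ≡⟨ sortRun-pair (countdownWith xs) k<x k<x₀ (Maybe.map s≤s (head-countdownWith xs)) ⟩
    x ∷ suc (length xs) ∷
      sortRun T123-132 (length (countdownWith xs) * 2 + 1 + F) (countdownWith xs) (x₀ ∷ [])
  ≡⟨ cong (λ out → x ∷ suc (length xs) ∷ out)
       (sortRun-countdownWith F x₀ xs (All.map (<-trans (n<1+n _)) (k<x₀ ∷ k<xs))) ⟩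
    x ∷ suc (length xs) ∷ swapPairs (countdownWith xs) ++ x₀ ∷ []
  ∎
  where open ≡-Reasoning

s-oddShape : ∀ x₀ xs → All (length xs <_) (x₀ ∷ xs) →
  s T123-132 (x₀ ∷ countdownWith xs) ≡ swapPairs (countdownWith xs) ++ x₀ ∷ []
s-oddShape x₀ xs large =
  trans (cong (λ F → sortRun T123-132 F (x₀ ∷ countdownWith xs) [])
              (fuel (length (countdownWith xs))))
        (sortRun-countdownWith 0 x₀ xs large)
  where
    fuel : ∀ n → 2 * suc n ≡ suc (n * 2 + 1 + 0)
    fuel = solve-∀

s-evenShape : ∀ x₀ z xs → All (length xs <_) (x₀ ∷ z ∷ xs) → z ≢ x₀ →
  s T123-132 (x₀ ∷ z ∷ countdownWith xs) ≡ z ∷ swapPairs (countdownWith xs) ++ x₀ ∷ []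
s-evenShape x₀ z xs (k<x₀ ∷ k<z ∷ k<xs) z≢x₀ = begin
    sortRun T123-132 (2 * length π) π []
  ≡⟨ cong (λ F → sortRun T123-132 F π []) (fuel (length (countdownWith xs))) ⟩
    sortRun T123-132 (suc (length (countdownWith xs) * 2 + 1 + 0)) (countdownWith xs) (z ∷ x₀ ∷ [])
  ≡⟨ sortRun-popAbove (countdownWith xs)
       (Maybe.map (λ a≤k → ≤-<-trans a≤k k<z , ≤-<-trans a≤k k<x₀) (head-countdownWith xs)) z≢x₀ ⟩
    z ∷ sortRun T123-132 (length (countdownWith xs) * 2 + 1 + 0) (countdownWith xs) (x₀ ∷ [])
  ≡⟨ cong (z ∷_) (sortRun-countdownWith 0 x₀ xs (k<x₀ ∷ k<xs)) ⟩
    z ∷ swapPairs (countdownWith xs) ++ x₀ ∷ []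
  ∎
  where
    open ≡-Reasoning
    π = x₀ ∷ z ∷ countdownWith xs
    fuel : ∀ n → 2 * suc (suc n) ≡ 3 + (n * 2 + 1 + 0)
    fuel = solve-∀

unique-++⇒≢ : ∀ {xs ys : List ℕ} {u v} → Unique (xs ++ ys) → u ∈ xs → v ∈ ys → u ≢ v
unique-++⇒≢ (u≢ ∷ _)  (here refl) v∈ys = All.lookup u≢ (∈-++⁺ʳ _ v∈ys)
unique-++⇒≢ (_ ∷ uq) (there u∈xs) v∈ys = unique-++⇒≢ uq u∈xs v∈ys

∉-applyDownFrom-suc⇒> : ∀ {k v} → 0 < v → v ∉ applyDownFrom suc k → k < v
∉-applyDownFrom-suc⇒> {k} {suc w} _ v∉ with k <? suc w
... | yes k<v = k<v
... | no  k≮v = contradiction (∈-applyDownFrom⁺ suc (≮⇒≥ k≮v)) v∉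

unique-positive⇒beyond : ∀ {l} k rest → Unique l → All (0 <_) l →
  l ↭ applyDownFrom suc k ++ rest → All (k <_) rest
unique-positive⇒beyond k rest uq pos l↭ = All.tabulate beyond
  where
    cd = applyDownFrom suc k
    beyond : ∀ {v} → v ∈ rest → k < v
    beyond v∈rest = ∉-applyDownFrom-suc⇒>
      (All.lookup (All.++⁻ʳ cd (All-resp-↭ l↭ pos)) v∈rest)
      (λ v∈cd → unique-++⇒≢ (Unique-resp-↭ (↭⇒↭ₛ l↭) uq) v∈cd v∈rest refl)

isPerm⇒unique : ∀ {π} → IsPerm π → Unique π
isPerm⇒unique perm = Unique-resp-↭ (↭⇒↭ₛ (↭-sym perm)) (Unique.map⁺ suc-injective (Unique.upTo⁺ _))

isPerm⇒positive : ∀ {π} → IsPerm π → All (0 <_) π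
isPerm⇒positive perm = All-resp-↭ (↭-sym perm) (All.map⁺ (All.universal (λ _ → z<s) _))

countdownWith-↭ : ∀ xs → countdownWith xs ↭ applyDownFrom suc (length xs) ++ xs
countdownWith-↭ []       = ↭-refl
countdownWith-↭ (x ∷ xs) = ↭-prep _ (↭-trans (↭-prep x (countdownWith-↭ xs))
                                             (↭-sym (shift x (applyDownFrom suc (length xs)) xs)))

isPerm-countdownWith⇒beyond : ∀ p xs → IsPerm (p ++ countdownWith xs) → All (length xs <_) (p ++ xs)
isPerm-countdownWith⇒beyond p xs perm =
  unique-positive⇒beyond (length xs) (p ++ xs) (isPerm⇒unique perm) (isPerm⇒positive perm)
    (↭-trans (++⁺ˡ p (countdownWith-↭ xs)) (shifts p (applyDownFrom suc (length xs))))

countdownWith-shape : ∀ m r → length r ≡ m * 2 → (∀ i → i < m → at r (1 + i * 2) ≡ m ∸ i) →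
  Σ[ xs ∈ List ℕ ] length xs ≡ m × r ≡ countdownWith xs
countdownWith-shape zero    []            _   _    = [] , refl , refl
countdownWith-shape (suc m) (y ∷ x ∷ r) len at-r
  with countdownWith-shape m r (suc-injective (suc-injective len))
                                (λ i i<m → at-r (suc i) (s≤s i<m))
... | xs , refl , refl = x ∷ xs , refl , cong (_∷ x ∷ countdownWith xs) (at-r 0 z<s)

m≤[2*m+n]/2 : ∀ m n → m ≤ (2 * m + n) / 2
m≤[2*m+n]/2 m n = begin
  m             ≡⟨ m*n/n≡m m 2 ⟨
  m * 2 / 2     ≡⟨ cong (_/ 2) (*-comm m 2) ⟩
  2 * m / 2     ≤⟨ /-monoˡ-≤ 2 (m≤m+n (2 * m) n) ⟩
  (2 * m + n) / 2 ∎
  where open ≤-Reasoning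

-- Reindexed by j = m ∸ i: entry j of the decreasing half sits at position 2 + d + 2i.
halfDecreasing-at : ∀ {π} m d → length π ≡ 2 * m + suc d → HalfDecreasing π →
  ∀ i → i < m → at π (2 + d + i * 2) ≡ m ∸ i
halfDecreasing-at {π} m d len hd i i<m =
  trans (cong (at π) (sym position)) (hd (m ∸ i) (m<n⇒0<n∸m i<m) (≤-trans (m∸n≤m m i) half))
  where
    half : m ≤ (length π ∸ 1) / 2
    half = subst (λ n → m ≤ n / 2) (sym (cong (_∸ 1) (trans len (+-suc (2 * m) d))))
                 (m≤[2*m+n]/2 m d)
    regroup : ∀ i e d → 2 * (i + e) + suc d + 1 ≡ 2 * e + (2 + d + i * 2)
    regroup = solve-∀
    position : length π + 1 ∸ 2 * (m ∸ i) ≡ 2 + d + i * 2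
    position = begin
        length π + 1 ∸ 2 * (m ∸ i)
      ≡⟨ cong (λ n → n + 1 ∸ 2 * (m ∸ i)) len ⟩
        2 * m + suc d + 1 ∸ 2 * (m ∸ i)
      ≡⟨ cong (λ n → 2 * n + suc d + 1 ∸ 2 * (m ∸ i)) (m+[n∸m]≡n (<⇒≤ i<m)) ⟨
        2 * (i + (m ∸ i)) + suc d + 1 ∸ 2 * (m ∸ i)
      ≡⟨ cong (_∸ 2 * (m ∸ i)) (regroup i (m ∸ i) d) ⟩
        2 * (m ∸ i) + (2 + d + i * 2) ∸ 2 * (m ∸ i)
      ≡⟨ m+n∸m≡n (2 * (m ∸ i)) _ ⟩
        2 + d + i * 2
      ∎
      where open ≡-Reasoning

concat-applyUpTo-swapPairs : ∀ m r (f : ℕ → List ℕ) → length r ≡ m * 2 →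
  (∀ j → f j ≡ at r (2 + j * 2) ∷ at r (1 + j * 2) ∷ []) → concat (applyUpTo f m) ≡ swapPairs r
concat-applyUpTo-swapPairs zero    []          f _   _  = refl
concat-applyUpTo-swapPairs (suc m) (a ∷ b ∷ r) f len f≡ =
  cong₂ _++_ (f≡ 0)
    (concat-applyUpTo-swapPairs m r (f ∘ suc) (suc-injective (suc-injective len)) (f≡ ∘ suc))

map-at-pairPositions : ∀ l r m (h : ℕ → List ℕ) → length r ≡ m * 2 →
  (∀ j → map (at l) (h (suc j)) ≡ at r (2 + j * 2) ∷ at r (1 + j * 2) ∷ []) →
  map (at l) (concat (map h (oneTo m)) ++ 1 ∷ []) ≡ swapPairs r ++ at l 1 ∷ []
map-at-pairPositions l r m h len h≡ = begin
    map (at l) (concat (map h (oneTo m)) ++ 1 ∷ [])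
  ≡⟨ map-++ (at l) _ (1 ∷ []) ⟩
    map (at l) (concat (map h (oneTo m))) ++ at l 1 ∷ []
  ≡⟨ cong (_++ at l 1 ∷ []) (map-concatMap (at l) h (oneTo m)) ⟩
    concat (map (map (at l) ∘ h) (map suc (upTo m))) ++ at l 1 ∷ []
  ≡⟨ cong (λ ps → concat ps ++ at l 1 ∷ []) (trans (sym (map-∘ (upTo m))) (map-upTo _ m)) ⟩
    concat (applyUpTo (map (at l) ∘ h ∘ suc) m) ++ at l 1 ∷ []
  ≡⟨ cong (_++ at l 1 ∷ []) (concat-applyUpTo-swapPairs m r _ len h≡) ⟩
    swapPairs r ++ at l 1 ∷ []
  ∎
  where open ≡-Reasoning

2*[1+j]+c≡2+c+j*2 : ∀ j c → 2 * suc j + c ≡ 2 + c + j * 2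
2*[1+j]+c≡2+c+j*2 j c = trans (cong (_+ c) (*-comm 2 (suc j))) (cong (2 +_) (+-comm (j * 2) c))

oddPositions-at : ∀ x₀ r m → length r ≡ m * 2 →
  map (at (x₀ ∷ r)) (oddPositions m) ≡ swapPairs r ++ x₀ ∷ []
oddPositions-at x₀ r m len = map-at-pairPositions (x₀ ∷ r) r m _ len λ j →
  cong₂ (λ p q → at (x₀ ∷ r) p ∷ at (x₀ ∷ r) q ∷ []) (2*[1+j]+c≡2+c+j*2 j 1) (*-comm 2 (suc j))

evenPositions-at : ∀ x₀ z r m → length r ≡ m * 2 →
  map (at (x₀ ∷ z ∷ r)) (evenPositions m) ≡ z ∷ swapPairs r ++ x₀ ∷ []
evenPositions-at x₀ z r m len = cong (z ∷_) (map-at-pairPositions (x₀ ∷ z ∷ r) r m _ len λ j →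
  cong₂ (λ p q → at (x₀ ∷ z ∷ r) p ∷ at (x₀ ∷ z ∷ r) q ∷ [])
        (2*[1+j]+c≡2+c+j*2 j 2) (2*[1+j]+c≡2+c+j*2 j 1))

c+n≡2*m+c⇒n≡m*2 : ∀ c {n} m → c + n ≡ 2 * m + c → n ≡ m * 2
c+n≡2*m+c⇒n≡m*2 c m eq =
  +-cancelˡ-≡ c _ _ (trans eq (trans (+-comm (2 * m) c) (cong (c +_) (*-comm 2 m))))

s-oddLength : ∀ π → IsPerm π → HalfDecreasing π → ∀ m → length π ≡ 2 * m + 1 →
  s T123-132 π ≡ map (at π) (oddPositions m)
s-oddLength []       _    _  m len = contradiction (trans len (+-comm (2 * m) 1)) 0≢1+n
s-oddLength (x₀ ∷ r) perm hd m len with c+n≡2*m+c⇒n≡m*2 1 m len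
... | len-r with countdownWith-shape m r len-r (halfDecreasing-at m 0 len hd)
... | xs , refl , refl =
  trans (s-oddShape x₀ xs (isPerm-countdownWith⇒beyond (x₀ ∷ []) xs perm))
        (sym (oddPositions-at x₀ (countdownWith xs) (length xs) len-r))

s-evenLength : ∀ π → IsPerm π → HalfDecreasing π → ∀ m → length π ≡ 2 * m + 2 →
  s T123-132 π ≡ map (at π) (evenPositions m)
s-evenLength []           _    _  m len = contradiction (trans len (+-comm (2 * m) 2)) 0≢1+n
s-evenLength (_ ∷ [])     _    _  m len =
  contradiction (suc-injective (trans len (+-comm (2 * m) 2))) 0≢1+n
s-evenLength (x₀ ∷ z ∷ r) perm hd m len with c+n≡2*m+c⇒n≡m*2 2 m len
... | len-r with countdownWith-shape m r len-r (halfDecreasing-at m 1 len hd)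
... | xs , refl , refl
  with isPerm-countdownWith⇒beyond (x₀ ∷ z ∷ []) xs perm | isPerm⇒unique perm
... | k<x₀ ∷ k<z ∷ k<xs | x₀∉ ∷ _ =
  trans (s-evenShape x₀ z xs (k<x₀ ∷ k<z ∷ k<xs) (≢-sym (All.head x₀∉)))
        (sym (evenPositions-at x₀ z (countdownWith xs) (length xs) len-r))

lemma4p1 : (π : List ℕ) → IsPerm π → length π ≥ 3 → HalfDecreasing π →
    ((m : ℕ) → length π ≡ 2 * m + 1 → s T123-132 π ≡ map (at π) (oddPositions m))
    × ((m : ℕ) → length π ≡ 2 * m + 2 → s T123-132 π ≡ map (at π) (evenPositions m))
lemma4p1 π perm _ hd = s-oddLength π perm hd , s-evenLength π perm hd
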